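{- Fix an integer $1\leq a\leq b-1$ and an integer $N\ge1$. If $n$ is a nonnegative integer with $n\leq (N-N_{a,A})b$, $n\equiv a \pmod b$ and $n\notin \mathcal E(A)$, then $n\in NA$.
   Context: $A$ is a finite set of integers with smallest element $0$, largest element $b\ge1$, and gcd of its elements equal to $1$. $\mathbb N=\{0,1,2,\dots\}$. For an integer $N\ge1$, $NA=\{a_1+\cdots+a_N:a_i\in A\}$ (repetitions allowed), and $0A=\{0\}$. $\mathcal P(A)=\{\sum_{x\in A} n_x x: n_x\in\mathbb N\}$ and $\mathcal E(A)=\mathbb N\setminus\mathcal P(A)$. For an integer $c$, $n_{c,A}=\min\{n\ge 0: n\equiv c\pmod b,\ n\in\mathcal P(A)\}$ and $N_{c,A}=\min\{N\ge0: n_{c,A}\in NA\}$. -}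

module Defs where

open import Data.Nat using (ℕ; zero; suc; _+_; _*_; _≤_; _<_)
open import Data.Nat.GCD using (gcd)
open import Data.Integer as ℤ using (ℤ; +_)
open import Data.Integer.Divisibility as ℤd using ()
open import Data.List using (List; foldr; length; zipWith)
import Data.Nat.ListAction as ListAction
open import Data.List.Membership.Propositional using (_∈_)
open import Data.List.Relation.Unary.All as LAll using ()
open import Data.Vec as Vec using (Vec)
open import Data.Vec.Relation.Unary.All as VAll using ()
open import Data.Product using (Σ; _×_)
open import Relation.Binary.PropositionalEquality using (_≡_)
open import Relation.Nullary using (¬_)

-- A finite set of integers is represented by a list of naturals (all
-- elements are ≥ 0 since the smallest element is 0).

gcdList : List ℕ → ℕ
gcdList = foldr gcd 0

record Standing (A : List ℕ) (b : ℕ) : Set where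
  field
    zero∈A : 0 ∈ A
    b∈A    : b ∈ A
    ≤b     : LAll.All (_≤ b) A
    b≥1    : 1 ≤ b
    gcd≡1  : gcdList A ≡ 1

_≡_[mod_] : ℕ → ℕ → ℕ → Set
x ≡ y [mod m ] = (+ m) ℤd.∣ ((+ x) ℤ.- (+ y))

InSumset : ℕ → List ℕ → ℕ → Set
InSumset N A n = Σ (Vec ℕ N) λ v → VAll.All (_∈ A) v × Vec.sum v ≡ n

InP : List ℕ → ℕ → Set
InP A n = Σ (List ℕ) λ c → (length c ≡ length A) × (ListAction.sum (zipWith _*_ c A) ≡ n)

InE : List ℕ → ℕ → Set
InE A n = ¬ InP A n

IsNc : List ℕ → ℕ → ℕ → ℕ → Set
IsNc A b c m =
  (m ≡ c [mod b ]) × InP A m × (∀ k → k < m → k ≡ c [mod b ] → ¬ InP A k)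

IsBigNc : List ℕ → ℕ → ℕ → Set
IsBigNc A m M = InSumset M A m × (∀ K → K < M → ¬ InSumset K A m)

{-# OPTIONS --safe #-}
module Submission where

-- Since n ∈ 𝒫(A) and n ≡ a (mod b), minimality of n_{a,A} gives n ≥ n_{a,A}, so
-- n = n_{a,A} + k b for some k ≥ 0. Adding k copies of b ∈ A to a representation
-- of n_{a,A} as a sum of N_{a,A} elements puts n in (N_{a,A} + k) A, and
-- n ≤ (N − N_{a,A}) b forces N_{a,A} + k ≤ N; the remaining summands are 0 ∈ A.

open import Defs
open import Data.Nat using (ℕ; zero; suc; _+_; _*_; _≤_; _∸_; _≤?_; >-nonZero)
open import Data.Nat.Properties
open import Data.Nat.Divisibility using (_∣_; divides)
import Data.Integer as ℤ
open import Data.Integer.Properties using (m-n≡m⊖n; ⊖-≥)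
open import Data.Integer.Divisibility.Signed as ℤ∣ using (∣ᵤ⇒∣; ∣⇒∣ᵤ; ∣m∣n⇒∣m-n)
open import Data.Integer.Solver using (module +-*-Solver)
open import Data.List using (List)
open import Data.List.Membership.Propositional using (_∈_)
open import Data.Vec using (_∷_)
open import Data.Vec.Relation.Unary.All using (_∷_)
open import Data.Product using (∃; _,_)
open import Relation.Binary.PropositionalEquality
open import Relation.Nullary using (¬_; yes; no; contradiction)

InSumset-0∷ : ∀ {A m x} → 0 ∈ A → InSumset m A x → InSumset (suc m) A x
InSumset-0∷ 0∈A (v , v⊆A , Σv≡x) = 0 ∷ v , 0∈A ∷ v⊆A , Σv≡x

InSumset-mono : ∀ {A m M x} → 0 ∈ A → m ≤ M → InSumset m A x → InSumset M A x
InSumset-mono {A} {m} {M} {x} 0∈A m≤M x∈mA =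
  subst (λ K → InSumset K A x) (m∸n+n≡m m≤M) (pad (M ∸ m))
  where
  pad : ∀ d → InSumset (d + m) A x
  pad zero    = x∈mA
  pad (suc d) = InSumset-0∷ 0∈A (pad d)

InSumset-+* : ∀ {A m x b} → b ∈ A → ∀ k → InSumset m A x → InSumset (k + m) A (k * b + x)
InSumset-+* b∈A zero x∈mA = x∈mA
InSumset-+* {x = x} {b} b∈A (suc k) x∈mA with InSumset-+* b∈A k x∈mA
... | v , v⊆A , Σv≡ = b ∷ v , b∈A ∷ v⊆A , trans (cong (b +_) Σv≡) (sym (+-assoc b (k * b) x))

∣-∸-of-≡[mod] : ∀ {m a x y} → x ≡ a [mod m ] → y ≡ a [mod m ] → y ≤ x → m ∣ x ∸ y
∣-∸-of-≡[mod] {m} {a} {x} {y} x≡a y≡a y≤x =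
  subst (m ∣_) ∣x-y∣≡x∸y (∣⇒∣ᵤ (subst (ℤ.+ m ℤ∣.∣_) (cancel-a (ℤ.+ x) (ℤ.+ y) (ℤ.+ a))
    (∣m∣n⇒∣m-n (∣ᵤ⇒∣ {i = ℤ.+ x ℤ.- ℤ.+ a} x≡a) (∣ᵤ⇒∣ {i = ℤ.+ y ℤ.- ℤ.+ a} y≡a))))
  where
  cancel-a : ∀ i j k → (i ℤ.- k) ℤ.- (j ℤ.- k) ≡ i ℤ.- j
  cancel-a = solve 3 (λ i j k → (i :- k) :- (j :- k) := i :- j) refl
    where open +-*-Solver
  ∣x-y∣≡x∸y : ℤ.∣ ℤ.+ x ℤ.- ℤ.+ y ∣ ≡ x ∸ y
  ∣x-y∣≡x∸y = cong ℤ.∣_∣ (trans (m-n≡m⊖n x y) (⊖-≥ y≤x))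

≡[mod]-≤⇒+* : ∀ {m a x y} → x ≡ a [mod m ] → y ≡ a [mod m ] → y ≤ x →
              ∃ λ k → k * m + y ≡ x
≡[mod]-≤⇒+* {m} {a} {x} {y} x≡a y≡a y≤x with ∣-∸-of-≡[mod] {m} {a} x≡a y≡a y≤x
... | divides k x∸y≡km = k , trans (cong (_+ y) (sym x∸y≡km)) (m∸n+n≡m y≤x)

IsNc-minimal : ∀ {A b c m n} → IsNc A b c m → n ≡ c [mod b ] → ¬ InE A n → m ≤ n
IsNc-minimal {m = m} {n} (_ , _ , below-m-∉P) n≡c n∉E with m ≤? n
... | yes m≤n = m≤n
... | no  m≰n = contradiction (below-m-∉P n (≰⇒> m≰n) n≡c) n∉E

mainTheorem10 : (A : List ℕ) (b : ℕ) → Standing A b →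
    (a : ℕ) → 1 ≤ a → a ≤ b ∸ 1 →
    (N : ℕ) → 1 ≤ N →
    (nA NA : ℕ) → IsNc A b a nA → IsBigNc A nA NA →
    (n : ℕ) → n + NA * b ≤ N * b → n ≡ a [mod b ] → ¬ InE A n →
    InSumset N A n
mainTheorem10 A b st a _ _ N _ nA NA isNc@(nA≡a , _) (nA∈NA·A , _) n n+NAb≤Nb n≡a n∉E
  with ≡[mod]-≤⇒+* {b} {a} n≡a nA≡a (IsNc-minimal {c = a} isNc n≡a n∉E)
... | k , kb+nA≡n =
  InSumset-mono zero∈A k+NA≤N (subst (InSumset (k + NA) A) kb+nA≡n (InSumset-+* b∈A k nA∈NA·A))
  where
  open Standing st
  k+NA≤N : k + NA ≤ N
  k+NA≤N = *-cancelʳ-≤ (k + NA) N b {{>-nonZero b≥1}} (begin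
    (k + NA) * b    ≡⟨ *-distribʳ-+ b k NA ⟩
    k * b + NA * b  ≤⟨ +-monoˡ-≤ (NA * b) (≤-trans (m≤m+n (k * b) nA) (≤-reflexive kb+nA≡n)) ⟩
    n + NA * b      ≤⟨ n+NAb≤Nb ⟩
    N * b           ∎)
    where open ≤-Reasoning
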